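{- Let $\mathcal{C}$ be a class of leaf-labeled phylogenetic networks which is closed under permutations of the leaf labels, and let $\mathcal{C}_\ell$ denote the set of networks in $\mathcal{C}$ with $\ell$ leaves (finite). Then for every $\ell$, the rational number $|\mathcal{C}_\ell|/\ell!$, written in lowest terms, has a denominator which is a power of $2$.
   Context: A (binary) phylogenetic network is a rooted connected directed acyclic graph without multiple edges whose vertices are: a unique root (indegree $0$, outdegree $2$); leaves (indegree $1$, outdegree $0$); tree vertices (indegree $1$, outdegree $2$); reticulation vertices (indegree $2$, outdegree $1$). It is leaf-labeled if its $\ell$ leaves are bijectively labeled by $\{1,\dots,\ell\}$; two leaf-labeled networks are the same iff there is a directed-graph isomorphism between them preserving leaf labels. -}

module Defs where

open import Data.Nat using (ℕ; zero; suc; _+_)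
open import Data.Bool using (Bool; true; false; if_then_else_)
open import Data.Fin using (Fin; zero; suc)
open import Data.Product using (Σ; ∃; ∃-syntax; _×_; _,_)
open import Data.Sum using (_⊎_)
open import Relation.Binary.PropositionalEquality using (_≡_)
open import Relation.Nullary using (¬_)
open import Function.Definitions using (Injective)
open import Function.Bundles using (_↔_; Inverse)
open import Data.Fin.Permutation using (Permutation′; _⟨$⟩ʳ_)

countTrue : ∀ {n} → (Fin n → Bool) → ℕ
countTrue {zero}  p = 0
countTrue {suc n} p = (if p zero then 1 else 0) + countTrue (λ i → p (suc i))

data Path {n : ℕ} (E : Fin n → Fin n → Bool) : Fin n → Fin n → Set where
  edge : ∀ {u v} → E u v ≡ true → Path E u v
  step : ∀ {u w v} → E u w ≡ true → Path E w v → Path E u v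

-- A binary phylogenetic network with ℓ leaves labeled bijectively by Fin ℓ.
-- Vertex set Fin n; edge relation as a Bool-valued adjacency function
-- (hence no multiple edges).
record Network (ℓ : ℕ) : Set where
  field
    n      : ℕ
    E      : Fin n → Fin n → Bool
    acyclic : ∀ v → ¬ Path E v v
    root   : Fin n
  indeg : Fin n → ℕ
  indeg v = countTrue (λ u → E u v)
  outdeg : Fin n → ℕ
  outdeg v = countTrue (λ w → E v w)
  IsLeaf : Fin n → Set
  IsLeaf v = indeg v ≡ 1 × outdeg v ≡ 0
  field
    root-in  : indeg root ≡ 0
    root-out : outdeg root ≡ 2
    root-unique : ∀ v → indeg v ≡ 0 → v ≡ root
    vertex-kind : ∀ v → ¬ (v ≡ root) →
      (indeg v ≡ 1 × outdeg v ≡ 0) ⊎ (indeg v ≡ 1 × outdeg v ≡ 2) ⊎ (indeg v ≡ 2 × outdeg v ≡ 1)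
    connected : ∀ v → v ≡ root ⊎ Path E root v
    label       : Fin ℓ → Fin n
    label-inj   : Injective _≡_ _≡_ label
    label-leaf  : ∀ i → IsLeaf (label i)
    label-onto  : ∀ v → IsLeaf v → ∃[ i ] label i ≡ v

open Network

IsoVia : ∀ {ℓ} → (Fin ℓ → Fin ℓ) → Network ℓ → Network ℓ → Set
IsoVia τ N M =
  Σ (Fin (n N) ↔ Fin (n M)) λ f →
    (∀ u v → E M (Inverse.to f u) (Inverse.to f v) ≡ E N u v) ×
    (∀ i → Inverse.to f (label N i) ≡ label M (τ i))

_≅_ : ∀ {ℓ} → Network ℓ → Network ℓ → Set
N ≅ M = IsoVia (λ i → i) N M

Class : Set₁
Class = (ℓ : ℕ) → Network ℓ → Set

-- Closed under permutations of leaf labels (networks being identified up to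
-- isomorphism, this includes invariance under label-preserving isomorphism):
-- if N ∈ C and M is N with labels permuted by σ, then M ∈ C.
ClosedUnderPermutations : Class → Set
ClosedUnderPermutations C =
  ∀ ℓ (σ : Permutation′ ℓ) (N M : Network ℓ) →
    C ℓ N → IsoVia (σ ⟨$⟩ʳ_) N M → C ℓ M

-- C_ℓ is finite with exactly k elements (isomorphism classes): an enumeration
-- by Fin k of pairwise non-isomorphic members covering C_ℓ up to isomorphism.
HasCard : Class → (ℓ k : ℕ) → Set
HasCard C ℓ k =
  Σ (Fin k → Network ℓ) λ rep →
    (∀ i → C ℓ (rep i)) ×
    (∀ i j → rep i ≅ rep j → i ≡ j) ×
    (∀ N → C ℓ N → ∃[ i ] N ≅ rep i)

module Submission where

-- Sym ℓ acts on the k isomorphism classes of C_ℓ by permuting leaf labels.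
-- The stabilizer of the class of N is the image of Aut N in Sym ℓ, with kernel
-- the automorphisms fixing the root and all leaves.  Every group of
-- automorphisms fixing pointwise a vertex set F ∋ root is a 2-group: some
-- vertex v ∉ F has a parent p ∈ F, the orbit of v consists of children of p
-- (at most two), and its stabilizer fixes F ∪ {v}.  So each stabilizer has
-- order 2^e, orbit–stabilizer gives ℓ! ∣ |orbit|·2^e, summing over the orbits
-- ℓ! ∣ k·2^e, and then the reduced denominator of k/ℓ! divides 2^e.

open import Data.Nat using (ℕ; zero; suc; _+_; _*_; _^_; _≤_; _<_; z≤n; s≤s; _!; NonZero)
open import Data.Nat.Properties
open import Data.Bool using (Bool; true; false; if_then_else_; _∧_; _∨_; not)
import Data.Bool.Properties as BoolP
open import Data.Fin using (Fin; zero; suc; punchIn; remQuot; combine)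
import Data.Fin.Properties as FinP
open import Data.Product using (∃-syntax; _×_; _,_; proj₁; proj₂)
open import Data.Sum using (_⊎_; inj₁; inj₂)
open import Relation.Binary.PropositionalEquality
open import Relation.Nullary using (¬_; Dec; yes; no; does)
open import Relation.Nullary.Decidable using (dec-true; _×-dec_)
open import Data.Empty using (⊥-elim)
open import Data.Fin.Permutation as Perm
  using (Permutation′; _⟨$⟩ʳ_; _⟨$⟩ˡ_; inverseˡ; inverseʳ; permutation; _∘ₚ_; insert; remove)
open import Algebra.Properties.CommutativeMonoid.Sum +-0-commutativeMonoid
  using (sum; sum-cong-≗; sum-permute; ∑-comm)
open import Function.Bundles using (Inverse)
open import Function.Construct.Composition using (_↔-∘_)
open import Function.Construct.Symmetry using (↔-sym)
open import Function.Construct.Identity using (↔-id)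
open import Data.Nat.Base using (≢-nonZero; ≢-nonZero⁻¹)
open import Data.Nat.Divisibility using (_∣_; divides; _∣?_; _∣0; ∣m∣n⇒∣m+n; ∣m⇒∣m*n; *-cancelʳ-∣; ∣1⇒≡1; 0∣⇒≡0; ∣⇒≤)
open import Data.Nat.Coprimality using (Coprime; coprime-divisor; recompute) renaming (sym to Coprime-sym)
import Data.Integer as ℤ
open import Data.Integer using (∣_∣)
import Data.Integer.Properties as ℤP
open import Data.Integer.GCD using (gcd)
open import Data.Rational using (mkℚ; _/_; ↧ₙ_; ↥_; ↧_)
open import Data.Rational.Properties using (↥-/; ↧-/)
open import Defs

bool-ext : ∀ {a b : Bool} → (a ≡ true → b ≡ true) → (b ≡ true → a ≡ true) → a ≡ b
bool-ext {true}  f g = sym (f refl)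
bool-ext {false} {false} f g = refl
bool-ext {false} {true}  f g = g refl

∧-elim : ∀ {a b : Bool} → (a ∧ b) ≡ true → a ≡ true × b ≡ true
∧-elim {true} {true} _ = refl , refl

∧-intro : ∀ {a b : Bool} → a ≡ true → b ≡ true → (a ∧ b) ≡ true
∧-intro refl refl = refl

∨-elim : ∀ {a b : Bool} → (a ∨ b) ≡ true → a ≡ true ⊎ b ≡ true
∨-elim {true}  _ = inj₁ refl
∨-elim {false} q = inj₂ q

_==_ : ∀ {n} → Fin n → Fin n → Bool
a == b = does (a FinP.≟ b)

does-true : ∀ {A : Set} (d : Dec A) → does d ≡ true → A
does-true (yes a) _ = a

==⇒≡ : ∀ {n} {a b : Fin n} → a == b ≡ true → a ≡ b
==⇒≡ {a = a} {b} = does-true (a FinP.≟ b)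

≡⇒== : ∀ {n} {a b : Fin n} → a ≡ b → a == b ≡ true
≡⇒== {a = a} {b} = dec-true (a FinP.≟ b)

allB : ∀ {n} → (Fin n → Bool) → Bool
allB {zero}  p = true
allB {suc n} p = p zero ∧ allB (λ i → p (suc i))

anyB : ∀ {n} → (Fin n → Bool) → Bool
anyB {zero}  p = false
anyB {suc n} p = p zero ∨ anyB (λ i → p (suc i))

allB-elim : ∀ {n} {p : Fin n → Bool} → allB p ≡ true → ∀ i → p i ≡ true
allB-elim {suc n} {p} q zero    = proj₁ (∧-elim q)
allB-elim {suc n} {p} q (suc i) = allB-elim {p = λ i → p (suc i)} (proj₂ (∧-elim q)) i

allB-intro : ∀ {n} {p : Fin n → Bool} → (∀ i → p i ≡ true) → allB p ≡ true
allB-intro {zero}  h = refl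
allB-intro {suc n} {p} h = ∧-intro (h zero) (allB-intro {p = λ i → p (suc i)} (λ i → h (suc i)))

anyB-elim : ∀ {n} {p : Fin n → Bool} → anyB p ≡ true → ∃[ i ] p i ≡ true
anyB-elim {suc n} {p} q with ∨-elim q
... | inj₁ p0 = zero , p0
... | inj₂ ps with anyB-elim {p = λ i → p (suc i)} ps
...   | i , pi = suc i , pi

anyB-intro : ∀ {n} {p : Fin n → Bool} (i : Fin n) → p i ≡ true → anyB p ≡ true
anyB-intro {suc n} {p} zero    q rewrite q = refl
anyB-intro {suc n} {p} (suc i) q =
  trans (cong (p zero ∨_) (anyB-intro {p = λ i → p (suc i)} i q)) (BoolP.∨-zeroʳ (p zero))

anyB-false : ∀ {n} {p : Fin n → Bool} → anyB p ≡ false → ∀ i → p i ≡ false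
anyB-false {p = p} q i with p i in pi
... | false = refl
... | true  = trans (sym (anyB-intro i pi)) q

indicator : Bool → ℕ
indicator b = if b then 1 else 0

cnt : ∀ {n} → (Fin n → Bool) → ℕ
cnt p = sum (λ i → indicator (p i))

countTrue≡cnt : ∀ {n} (p : Fin n → Bool) → countTrue p ≡ cnt p
countTrue≡cnt {zero}  p = refl
countTrue≡cnt {suc n} p = cong (indicator (p zero) +_) (countTrue≡cnt (λ i → p (suc i)))

cnt-cong : ∀ {n} {p q : Fin n → Bool} → (∀ i → p i ≡ q i) → cnt p ≡ cnt q
cnt-cong e = sum-cong-≗ (λ i → cong indicator (e i))

cnt-permute : ∀ {n} (p : Fin n → Bool) (π : Permutation′ n) → cnt (λ i → p (π ⟨$⟩ʳ i)) ≡ cnt p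
cnt-permute p π = sym (sum-permute (λ i → indicator (p i)) π)

cnt-all : ∀ n → cnt {n} (λ _ → true) ≡ n
cnt-all zero    = refl
cnt-all (suc n) = cong suc (cnt-all n)

cnt-none : ∀ {n} {p : Fin n → Bool} → (∀ i → p i ≡ false) → cnt p ≡ 0
cnt-none {zero}  h = refl
cnt-none {suc n} {p} h rewrite h zero = cnt-none {p = λ i → p (suc i)} (λ i → h (suc i))

cnt-mono : ∀ {n} {p q : Fin n → Bool} → (∀ i → p i ≡ true → q i ≡ true) → cnt p ≤ cnt q
cnt-mono {zero} h = z≤n
cnt-mono {suc n} {p} {q} h with p zero in p0
... | true rewrite h zero p0 = s≤s (cnt-mono {p = λ i → p (suc i)} {q = λ i → q (suc i)} (λ i → h (suc i)))
... | false = ≤-trans (cnt-mono {p = λ i → p (suc i)} {q = λ i → q (suc i)} (λ i → h (suc i)))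
                      (m≤n+m _ (indicator (q zero)))

cnt-pos : ∀ {n} {p : Fin n → Bool} (i : Fin n) → p i ≡ true → 1 ≤ cnt p
cnt-pos {suc n} {p} zero q rewrite q = s≤s z≤n
cnt-pos {suc n} {p} (suc i) q =
  ≤-trans (cnt-pos {p = λ i → p (suc i)} i q) (m≤n+m _ (indicator (p zero)))

cnt-single : ∀ {n} {p : Fin n → Bool} (i₀ : Fin n) → p i₀ ≡ true → (∀ j → p j ≡ true → j ≡ i₀) →
             cnt p ≡ 1
cnt-single {suc n} {p} zero q u rewrite q = cong suc (cnt-none {p = λ i → p (suc i)} others)
  where
  others : ∀ i → p (suc i) ≡ false
  others i with p (suc i) in pi
  ... | false = refl
  ... | true with () ← u (suc i) pi
cnt-single {suc n} {p} (suc i₀) q u with p zero in p0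
... | true with () ← u zero p0
... | false = cnt-single {p = λ i → p (suc i)} i₀ q (λ j r → FinP.suc-injective (u (suc j) r))

cnt-split : ∀ {n} (p q : Fin n → Bool) → cnt p ≡ cnt (λ i → p i ∧ q i) + cnt (λ i → p i ∧ not (q i))
cnt-split {zero} p q = refl
cnt-split {suc n} p q with p zero | q zero
... | false | _     = cnt-split (λ i → p (suc i)) (λ i → q (suc i))
... | true  | true  = cong suc (cnt-split (λ i → p (suc i)) (λ i → q (suc i)))
... | true  | false = trans (cong suc (cnt-split (λ i → p (suc i)) (λ i → q (suc i)))) (sym (+-suc _ _))

cnt-strict : ∀ {n} {p q : Fin n → Bool} (j : Fin n) → (∀ i → p i ≡ true → q i ≡ true) →
             p j ≡ false → q j ≡ true → cnt p < cnt q
cnt-strict {p = p} {q} j p⊆q pj qj = begin-strict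
    cnt p                                             ≡⟨ cnt-cong p≡q∧p ⟩
    cnt (λ i → q i ∧ p i)                             <⟨ m<m+n _ (cnt-pos j q∧¬p) ⟩
    cnt (λ i → q i ∧ p i) + cnt (λ i → q i ∧ not (p i)) ≡⟨ cnt-split q p ⟨
    cnt q                                             ∎
  where
  open ≤-Reasoning
  p≡q∧p : ∀ i → p i ≡ (q i ∧ p i)
  p≡q∧p i = bool-ext (λ r → ∧-intro (p⊆q i r) r) (λ r → proj₂ (∧-elim r))
  q∧¬p : (q j ∧ not (p j)) ≡ true
  q∧¬p rewrite pj | qj = refl

sum-if : ∀ {n} (q : Fin n → Bool) (c : ℕ) → sum (λ i → if q i then c else 0) ≡ cnt q * c
sum-if {zero} q c = refl
sum-if {suc n} q c with q zero
... | true  = cong (c +_) (sum-if (λ i → q (suc i)) c)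
... | false = sum-if (λ i → q (suc i)) c

cnt-by-fibres : ∀ {n k} (p : Fin n → Bool) (R : Fin n → Fin k → Bool) →
                (∀ g → p g ≡ true → cnt (R g) ≡ 1) →
                sum (λ y → cnt (λ g → p g ∧ R g y)) ≡ cnt p
cnt-by-fibres {n} {k} p R functional =
  trans (∑-comm (λ y g → indicator (p g ∧ R g y))) (sum-cong-≗ fibre-of)
  where
  fibre-of : ∀ g → sum (λ y → indicator (p g ∧ R g y)) ≡ indicator (p g)
  fibre-of g with p g in pg
  ... | true  = functional g pg
  ... | false = cnt-none {k} (λ _ → refl)

-- Permutations of Fin m are encoded bijectively by Fin (m !): the code of π
-- combines π 0 with the code of π with 0 removed.  This makes subgroups of
-- the symmetric group decidable subsets of a finite set, so they can be counted.
decode : ∀ m → Fin (m !) → Permutation′ m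
decode zero    _ = Perm.id
decode (suc m) c = insert zero (proj₁ (remQuot {suc m} (m !) c)) (decode m (proj₂ (remQuot {suc m} (m !) c)))

encode : ∀ m → Permutation′ m → Fin (m !)
encode zero    π = zero
encode (suc m) π = combine {suc m} {m !} (π ⟨$⟩ʳ zero) (encode m (remove zero π))

insert-cong : ∀ {m} (j : Fin (suc m)) {π ρ : Permutation′ m} → π Perm.≈ ρ → insert zero j π Perm.≈ insert zero j ρ
insert-cong j π≈ρ zero    = refl
insert-cong j {π} {ρ} π≈ρ (suc k) = begin
  insert zero j π ⟨$⟩ʳ suc k ≡⟨ Perm.insert-punchIn zero j π k ⟩
  punchIn j (π ⟨$⟩ʳ k)        ≡⟨ cong (punchIn j) (π≈ρ k) ⟩
  punchIn j (ρ ⟨$⟩ʳ k)        ≡⟨ Perm.insert-punchIn zero j ρ k ⟨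
  insert zero j ρ ⟨$⟩ʳ suc k ∎
  where open ≡-Reasoning

remove-cong : ∀ {m} {π ρ : Permutation′ (suc m)} → π Perm.≈ ρ → remove zero π Perm.≈ remove zero ρ
remove-cong {m} {π} {ρ} π≈ρ k = FinP.punchIn-injective (π ⟨$⟩ʳ zero) _ _ (begin
  punchIn (π ⟨$⟩ʳ zero) (remove zero π ⟨$⟩ʳ k) ≡⟨ Perm.punchIn-permute π zero k ⟨
  π ⟨$⟩ʳ suc k                                ≡⟨ π≈ρ (suc k) ⟩
  ρ ⟨$⟩ʳ suc k                                ≡⟨ Perm.punchIn-permute ρ zero k ⟩
  punchIn (ρ ⟨$⟩ʳ zero) (remove zero ρ ⟨$⟩ʳ k) ≡⟨ cong (λ z → punchIn z (remove zero ρ ⟨$⟩ʳ k)) (π≈ρ zero) ⟨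
  punchIn (π ⟨$⟩ʳ zero) (remove zero ρ ⟨$⟩ʳ k) ∎)
  where open ≡-Reasoning

encode-cong : ∀ m {π ρ : Permutation′ m} → π Perm.≈ ρ → encode m π ≡ encode m ρ
encode-cong zero    π≈ρ = refl
encode-cong (suc m) {π} {ρ} π≈ρ =
  cong₂ (combine {suc m} {m !}) (π≈ρ zero) (encode-cong m (remove-cong {m} {π} {ρ} π≈ρ))

decode-encode : ∀ m (π : Permutation′ m) → decode m (encode m π) Perm.≈ π
decode-encode zero    π ()
decode-encode (suc m) π k = begin
  decode (suc m) (combine j (encode m (remove zero π))) ⟨$⟩ʳ k
    ≡⟨ cong (λ p → insert zero (proj₁ p) (decode m (proj₂ p)) ⟨$⟩ʳ k)
            (FinP.remQuot-combine {suc m} {m !} j (encode m (remove zero π))) ⟩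
  insert zero j (decode m (encode m (remove zero π))) ⟨$⟩ʳ k
    ≡⟨ insert-cong j (decode-encode m (remove zero π)) k ⟩
  insert zero j (remove zero π) ⟨$⟩ʳ k
    ≡⟨ Perm.insert-remove zero π k ⟩
  π ⟨$⟩ʳ k ∎
  where
  open ≡-Reasoning
  j = π ⟨$⟩ʳ zero

encode-decode : ∀ m (c : Fin (m !)) → encode m (decode m c) ≡ c
encode-decode zero    zero = refl
encode-decode (suc m) c = begin
  combine j (encode m (remove zero (insert zero j (decode m c′))))
    ≡⟨ cong (combine j) (encode-cong m (Perm.remove-insert zero j (decode m c′))) ⟩
  combine j (encode m (decode m c′))
    ≡⟨ cong (combine j) (encode-decode m c′) ⟩
  combine j c′
    ≡⟨ FinP.combine-remQuot {suc m} (m !) c ⟩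
  c ∎
  where
  open ≡-Reasoning
  j  = proj₁ (remQuot {suc m} (m !) c)
  c′ = proj₂ (remQuot {suc m} (m !) c)

module Sym (m : ℕ) where

  Code : Set
  Code = Fin (m !)

  ap : Code → Fin m → Fin m
  ap c x = decode m c ⟨$⟩ʳ x

  code-ext : {a b : Code} → (∀ x → ap a x ≡ ap b x) → a ≡ b
  code-ext {a} {b} h = trans (sym (encode-decode m a)) (trans (encode-cong m h) (encode-decode m b))

  infixr 7 _∙_
  infix 8 _⁻¹

  _∙_ : Code → Code → Code
  a ∙ b = encode m (decode m b ∘ₚ decode m a)

  _⁻¹ : Code → Code
  a ⁻¹ = encode m (Perm.flip (decode m a))

  ε : Code
  ε = encode m Perm.id

  ap-∙ : ∀ a b x → ap (a ∙ b) x ≡ ap a (ap b x)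
  ap-∙ a b = decode-encode m (decode m b ∘ₚ decode m a)

  ap-ε : ∀ x → ap ε x ≡ x
  ap-ε = decode-encode m Perm.id

  ap-⁻¹ˡ : ∀ a x → ap (a ⁻¹) (ap a x) ≡ x
  ap-⁻¹ˡ a x = trans (decode-encode m (Perm.flip (decode m a)) _) (inverseˡ (decode m a))

  ap-⁻¹ʳ : ∀ a x → ap a (ap (a ⁻¹) x) ≡ x
  ap-⁻¹ʳ a x = trans (cong (ap a) (decode-encode m (Perm.flip (decode m a)) x)) (inverseʳ (decode m a))

  ap-injective : ∀ a {x y : Fin m} → ap a x ≡ ap a y → x ≡ y
  ap-injective a {x} {y} q = trans (sym (ap-⁻¹ˡ a x)) (trans (cong (ap (a ⁻¹)) q) (ap-⁻¹ˡ a y))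

  ⁻¹-∙-cancel : ∀ h g → h ⁻¹ ∙ (h ∙ g) ≡ g
  ⁻¹-∙-cancel h g = code-ext λ x → begin
    ap (h ⁻¹ ∙ (h ∙ g)) x    ≡⟨ ap-∙ (h ⁻¹) _ x ⟩
    ap (h ⁻¹) (ap (h ∙ g) x) ≡⟨ cong (ap (h ⁻¹)) (ap-∙ h g x) ⟩
    ap (h ⁻¹) (ap h (ap g x)) ≡⟨ ap-⁻¹ˡ h _ ⟩
    ap g x                   ∎
    where open ≡-Reasoning

  ∙-⁻¹-cancel : ∀ h g → h ∙ (h ⁻¹ ∙ g) ≡ g
  ∙-⁻¹-cancel h g = code-ext λ x → begin
    ap (h ∙ (h ⁻¹ ∙ g)) x    ≡⟨ ap-∙ h _ x ⟩
    ap h (ap (h ⁻¹ ∙ g) x)   ≡⟨ cong (ap h) (ap-∙ (h ⁻¹) g x) ⟩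
    ap h (ap (h ⁻¹) (ap g x)) ≡⟨ ap-⁻¹ʳ h _ ⟩
    ap g x                   ∎
    where open ≡-Reasoning

  ⁻¹-∙ : ∀ a → a ⁻¹ ∙ a ≡ ε
  ⁻¹-∙ a = code-ext λ x → trans (ap-∙ (a ⁻¹) a x) (trans (ap-⁻¹ˡ a x) (sym (ap-ε x)))

  translate : Code → Permutation′ (m !)
  translate h = permutation (h ∙_) (h ⁻¹ ∙_) (∙-⁻¹-cancel h) (⁻¹-∙-cancel h)

record Subgroup (m : ℕ) : Set where
  open Sym m
  field
    member   : Code → Bool
    member-ε : member ε ≡ true
    member-∙ : ∀ a b → member a ≡ true → member b ≡ true → member (a ∙ b) ≡ true
    member-⁻¹ : ∀ a → member a ≡ true → member (a ⁻¹) ≡ true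

  member-translate : ∀ h g → member h ≡ true → member (h ∙ g) ≡ member g
  member-translate h g h∈H = bool-ext
    (λ hg∈H → subst (λ z → member z ≡ true) (⁻¹-∙-cancel h g) (member-∙ _ _ (member-⁻¹ h h∈H) hg∈H))
    (member-∙ h g h∈H)

  -- Counting H by the fibres of a relation R that is functional on H and
  -- compatible with left translation (the fibre over y of h is h times the
  -- fibre over y₀):  |H| = |image of R| · |fibre over y₀|.
  order-by-fibres : ∀ {k} (R : Code → Fin k → Bool) (y₀ : Fin k) →
    (∀ g → member g ≡ true → cnt (R g) ≡ 1) →
    (∀ h g y → R h y ≡ true → R (h ∙ g) y ≡ R g y₀) →
    cnt member ≡ cnt (λ y → anyB (λ g → member g ∧ R g y)) * cnt (λ g → member g ∧ R g y₀)
  order-by-fibres {k} R y₀ functional translate-fibre = begin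
    cnt member                                           ≡⟨ cnt-by-fibres member R functional ⟨
    sum (λ y → cnt (fibre y))                            ≡⟨ sum-cong-≗ fibre-size ⟩
    sum (λ y → if image y then cnt (fibre y₀) else 0)    ≡⟨ sum-if image (cnt (fibre y₀)) ⟩
    cnt image * cnt (fibre y₀)                           ∎
    where
    open ≡-Reasoning
    fibre : Fin k → Code → Bool
    fibre y g = member g ∧ R g y
    image : Fin k → Bool
    image y = anyB (fibre y)
    fibre-size : ∀ y → cnt (fibre y) ≡ (if image y then cnt (fibre y₀) else 0)
    fibre-size y with image y in iy
    ... | false = cnt-none (anyB-false {p = fibre y} iy)
    ... | true with anyB-elim iy
    ...   | h , h∈fibre = trans (sym (cnt-permute (fibre y) (translate h))) (cnt-cong λ g →
              cong₂ _∧_ (member-translate h g (proj₁ (∧-elim h∈fibre)))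
                        (translate-fibre h g y (proj₂ (∧-elim h∈fibre))))

record Action (m k : ℕ) : Set where
  open Sym m
  field
    act   : Code → Fin k → Fin k
    act-∙ : ∀ a b x → act (a ∙ b) x ≡ act a (act b x)
    act-ε : ∀ x → act ε x ≡ x

  act-⁻¹ˡ : ∀ a x → act (a ⁻¹) (act a x) ≡ x
  act-⁻¹ˡ a x = trans (sym (act-∙ (a ⁻¹) a x)) (trans (cong (λ z → act z x) (⁻¹-∙ a)) (act-ε x))

  act-injective : ∀ a {x y} → act a x ≡ act a y → x ≡ y
  act-injective a {x} {y} q = trans (sym (act-⁻¹ˡ a x)) (trans (cong (act (a ⁻¹)) q) (act-⁻¹ˡ a y))

module Orbits {m k : ℕ} (H : Subgroup m) (A : Action m k) where
  open Sym m
  open Subgroup H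
  open Action A

  orbit : Fin k → Fin k → Bool
  orbit x y = anyB (λ g → member g ∧ (act g x == y))

  stabilizer : Fin k → Code → Bool
  stabilizer x g = member g ∧ (act g x == x)

  orbit-intro : ∀ {x y} g → member g ≡ true → act g x ≡ y → orbit x y ≡ true
  orbit-intro g g∈H gx≡y = anyB-intro g (∧-intro g∈H (≡⇒== gx≡y))

  orbit-elim : ∀ {x y} → orbit x y ≡ true → ∃[ g ] (member g ≡ true × act g x ≡ y)
  orbit-elim o with anyB-elim o
  ... | g , q = g , proj₁ (∧-elim q) , ==⇒≡ (proj₂ (∧-elim q))

  orbit-refl : ∀ x → orbit x x ≡ true
  orbit-refl x = orbit-intro ε member-ε (act-ε x)

  orbit-back : ∀ {x y} g → member g ≡ true → orbit x (act g y) ≡ true → orbit x y ≡ true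
  orbit-back {x} {y} g g∈H o with orbit-elim o
  ... | h , h∈H , hx≡gy = orbit-intro (g ⁻¹ ∙ h) (member-∙ _ _ (member-⁻¹ g g∈H) h∈H)
          (trans (act-∙ (g ⁻¹) h x) (trans (cong (act (g ⁻¹)) hx≡gy) (act-⁻¹ˡ g y)))

  orbit-stabilizer : ∀ x → cnt member ≡ cnt (orbit x) * cnt (stabilizer x)
  orbit-stabilizer x = order-by-fibres (λ g y → act g x == y) x
    (λ g _ → cnt-single (act g x) (≡⇒== {a = act g x} refl) (λ y q → sym (==⇒≡ q)))
    (λ h g y hx≡y → bool-ext
      (λ q → ≡⇒== (act-injective h (trans (sym (act-∙ h g x)) (trans (==⇒≡ q) (sym (==⇒≡ hx≡y))))))
      (λ q → ≡⇒== (trans (act-∙ h g x) (trans (cong (act h) (==⇒≡ q)) (==⇒≡ hx≡y)))))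

  Invariant : (Fin k → Bool) → Set
  Invariant S = ∀ g x → member g ≡ true → S x ≡ true → S (act g x) ≡ true

  remove-orbit : (Fin k → Bool) → Fin k → Fin k → Bool
  remove-orbit S x y = S y ∧ not (orbit x y)

  remove-orbit-invariant : ∀ {S} x → Invariant S → Invariant (remove-orbit S x)
  remove-orbit-invariant {S} x inv g y g∈H q =
    ∧-intro (inv g y g∈H (proj₁ (∧-elim q))) outside
    where
    outside : not (orbit x (act g y)) ≡ true
    outside with orbit x (act g y) in o
    ... | false = refl
    ... | true with () ← trans (sym (cong not (orbit-back g g∈H o))) (proj₂ (∧-elim q))

  cnt-remove-orbit : ∀ {S} x → Invariant S → S x ≡ true →
                     cnt S ≡ cnt (orbit x) + cnt (remove-orbit S x)
  cnt-remove-orbit {S} x inv Sx = trans (cnt-split S (orbit x)) (cong (_+ cnt (remove-orbit S x)) (cnt-cong S∧orbit≡orbit))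
    where
    S∧orbit≡orbit : ∀ y → (S y ∧ orbit x y) ≡ orbit x y
    S∧orbit≡orbit y = bool-ext (λ q → proj₂ (∧-elim q)) (λ o → ∧-intro (inside o) o)
      where
      inside : orbit x y ≡ true → S y ≡ true
      inside o with orbit-elim o
      ... | g , g∈H , gx≡y = subst (λ z → S z ≡ true) gx≡y (inv g x g∈H Sx)

  -- A property of numbers that holds for 0, is closed under addition and
  -- holds for the size of every orbit holds for k, since Fin k is the
  -- disjoint union of the orbits.
  orbit-induction : (P : ℕ → Set) → P 0 → (∀ a b → P a → P b → P (a + b)) →
                    (∀ x → P (cnt (orbit x))) → P k
  orbit-induction P P0 P+ P-orbit =
    subst P (cnt-all k) (go k (λ _ → true) (≤-reflexive (cnt-all k)) (λ _ _ _ _ → refl))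
    where
    go : ∀ fuel S → cnt S ≤ fuel → Invariant S → P (cnt S)
    go fuel S bound inv with anyB S in nonempty
    ... | false = subst P (sym (cnt-none (anyB-false {p = S} nonempty))) P0
    ... | true with anyB-elim {p = S} nonempty
    go zero     S bound inv | true | x , Sx with () ← ≤-trans (cnt-pos {p = S} x Sx) bound
    go (suc fuel) S bound inv | true | x , Sx =
      subst P (sym (cnt-remove-orbit x inv Sx))
        (P+ _ _ (P-orbit x) (go fuel (remove-orbit S x) smaller (remove-orbit-invariant x inv)))
      where
      smaller : cnt (remove-orbit S x) ≤ fuel
      smaller = ≤-pred (≤-trans (cnt-strict {p = remove-orbit S x} {q = S} x (λ y q → proj₁ (∧-elim q)) x∉rest Sx) bound)
        where
        x∉rest : remove-orbit S x x ≡ false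
        x∉rest = trans (cong (λ b → S x ∧ not b) (orbit-refl x)) (BoolP.∧-zeroʳ (S x))

natural-action : ∀ m → Action m m
natural-action m = record { act = Sym.ap m ; act-∙ = Sym.ap-∙ m ; act-ε = Sym.ap-ε m }

leaving-edge : ∀ {n} {E : Fin n → Fin n → Bool} (F : Fin n → Bool) {u w} → Path E u w →
               F u ≡ true → F w ≡ false → ∃[ p ] ∃[ v ] (F p ≡ true × F v ≡ false × E p v ≡ true)
leaving-edge F {u} {w} (edge uw) Fu Fw = u , w , Fu , Fw , uw
leaving-edge F {u} (step {w = w′} uw′ path) Fu Fw with F w′ in Fw′
... | true  = leaving-edge F path Fw′ Fw
... | false = u , w′ , Fu , Fw′ , uw′

small-*-pow2 : ∀ a e → 1 ≤ a → a ≤ 2 → ∃[ f ] a * 2 ^ e ≡ 2 ^ f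
small-*-pow2 1 e _ _ = e , *-identityˡ (2 ^ e)
small-*-pow2 2 e _ _ = suc e , refl
small-*-pow2 (suc (suc (suc a))) e _ (s≤s (s≤s ()))

module Automorphisms {ℓ : ℕ} (N : Network ℓ) where
  open Network N
  open Sym n

  preserves-edges : Code → Bool
  preserves-edges c = allB (λ u → allB (λ v → does (E (ap c u) (ap c v) BoolP.≟ E u v)))

  preserves-edges-elim : ∀ {c} → preserves-edges c ≡ true → ∀ u v → E (ap c u) (ap c v) ≡ E u v
  preserves-edges-elim {c} q u v = does-true (E (ap c u) (ap c v) BoolP.≟ E u v) (allB-elim (allB-elim q u) v)

  preserves-edges-intro : ∀ {c} → (∀ u v → E (ap c u) (ap c v) ≡ E u v) → preserves-edges c ≡ true
  preserves-edges-intro {c} h =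
    allB-intro (λ u → allB-intro (λ v → dec-true (E (ap c u) (ap c v) BoolP.≟ E u v) (h u v)))

  fixes : (Fin n → Bool) → Code → Bool
  fixes F c = allB (λ v → not (F v) ∨ (ap c v == v))

  fixes-elim : ∀ {F c} → fixes F c ≡ true → ∀ v → F v ≡ true → ap c v ≡ v
  fixes-elim {F} {c} q v Fv with ∨-elim (allB-elim q v)
  ... | inj₂ cv≡v = ==⇒≡ cv≡v
  ... | inj₁ ¬Fv with () ← trans (sym ¬Fv) (cong not Fv)

  fixes-intro : ∀ {F c} → (∀ v → F v ≡ true → ap c v ≡ v) → fixes F c ≡ true
  fixes-intro {F} {c} h = allB-intro fixed
    where
    fixed : ∀ v → (not (F v) ∨ (ap c v == v)) ≡ true
    fixed v with F v in Fv
    ... | false = refl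
    ... | true  = ≡⇒== (h v Fv)

  Fixing : (Fin n → Bool) → Subgroup n
  Fixing F = record
    { member    = λ c → preserves-edges c ∧ fixes F c
    ; member-ε  = ∧-intro (preserves-edges-intro λ u v → cong₂ E (ap-ε u) (ap-ε v))
                          (fixes-intro λ v _ → ap-ε v)
    ; member-∙  = λ a b qa qb → ∧-intro
        (preserves-edges-intro λ u v → begin
           E (ap (a ∙ b) u) (ap (a ∙ b) v)   ≡⟨ cong₂ E (ap-∙ a b u) (ap-∙ a b v) ⟩
           E (ap a (ap b u)) (ap a (ap b v)) ≡⟨ preserves-edges-elim (proj₁ (∧-elim qa)) _ _ ⟩
           E (ap b u) (ap b v)               ≡⟨ preserves-edges-elim (proj₁ (∧-elim qb)) u v ⟩
           E u v                             ∎)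
        (fixes-intro λ v Fv → begin
           ap (a ∙ b) v    ≡⟨ ap-∙ a b v ⟩
           ap a (ap b v)   ≡⟨ cong (ap a) (fixes-elim (proj₂ (∧-elim qb)) v Fv) ⟩
           ap a v          ≡⟨ fixes-elim (proj₂ (∧-elim qa)) v Fv ⟩
           v               ∎)
    ; member-⁻¹ = λ a q → ∧-intro
        (preserves-edges-intro λ u v → begin
           E (ap (a ⁻¹) u) (ap (a ⁻¹) v)                   ≡⟨ preserves-edges-elim (proj₁ (∧-elim q)) _ _ ⟨
           E (ap a (ap (a ⁻¹) u)) (ap a (ap (a ⁻¹) v))     ≡⟨ cong₂ E (ap-⁻¹ʳ a u) (ap-⁻¹ʳ a v) ⟩
           E u v                                           ∎)
        (fixes-intro λ v Fv → trans (cong (ap (a ⁻¹)) (sym (fixes-elim (proj₂ (∧-elim q)) v Fv)))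
                                    (ap-⁻¹ˡ a v))
    }
    where open ≡-Reasoning

  Aut : Subgroup n
  Aut = Fixing (λ _ → false)

  IsAut : Code → Set
  IsAut c = Subgroup.member Aut c ≡ true

  aut-preserves-edges : ∀ {c} → IsAut c → ∀ u v → E (ap c u) (ap c v) ≡ E u v
  aut-preserves-edges q = preserves-edges-elim (proj₁ (∧-elim q))

  aut-intro : ∀ {c} → (∀ u v → E (ap c u) (ap c v) ≡ E u v) → IsAut c
  aut-intro {c} h = ∧-intro (preserves-edges-intro h) (fixes-intro {c = c} λ _ ())

  aut-indeg : ∀ {c} → IsAut c → ∀ v → indeg (ap c v) ≡ indeg v
  aut-indeg {c} q v = begin
    countTrue (λ u → E u (ap c v))  ≡⟨ countTrue≡cnt (λ u → E u (ap c v)) ⟩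
    cnt (λ u → E u (ap c v))        ≡⟨ cnt-permute (λ u → E u (ap c v)) (decode n c) ⟨
    cnt (λ u → E (ap c u) (ap c v)) ≡⟨ cnt-cong (λ u → aut-preserves-edges q u v) ⟩
    cnt (λ u → E u v)               ≡⟨ countTrue≡cnt (λ u → E u v) ⟨
    countTrue (λ u → E u v)         ∎
    where open ≡-Reasoning

  aut-outdeg : ∀ {c} → IsAut c → ∀ v → outdeg (ap c v) ≡ outdeg v
  aut-outdeg {c} q v = begin
    countTrue (λ u → E (ap c v) u)  ≡⟨ countTrue≡cnt (λ u → E (ap c v) u) ⟩
    cnt (λ u → E (ap c v) u)        ≡⟨ cnt-permute (λ u → E (ap c v) u) (decode n c) ⟨
    cnt (λ u → E (ap c v) (ap c u)) ≡⟨ cnt-cong (λ u → aut-preserves-edges q v u) ⟩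
    cnt (λ u → E v u)               ≡⟨ countTrue≡cnt (λ u → E v u) ⟨
    countTrue (λ u → E v u)         ∎
    where open ≡-Reasoning

  -- the root is the only vertex of indegree 0, so every automorphism fixes it
  aut-fixes-root : ∀ {c} → IsAut c → ap c root ≡ root
  aut-fixes-root q = root-unique _ (trans (aut-indeg q root) root-in)

  aut-leaf : ∀ {c} → IsAut c → ∀ v → IsLeaf v → IsLeaf (ap c v)
  aut-leaf q v (in1 , out0) = trans (aut-indeg q v) in1 , trans (aut-outdeg q v) out0

  outdeg≤2 : ∀ p → outdeg p ≤ 2
  outdeg≤2 p with p FinP.≟ root
  ... | yes refl = ≤-reflexive root-out
  ... | no p≢root with vertex-kind p p≢root
  ...   | inj₁ (_ , out0)        = ≤-trans (≤-reflexive out0) z≤n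
  ...   | inj₂ (inj₁ (_ , out2)) = ≤-reflexive out2
  ...   | inj₂ (inj₂ (_ , out1)) = ≤-trans (≤-reflexive out1) (s≤s z≤n)

  _+v_ : (Fin n → Bool) → Fin n → Fin n → Bool
  (F +v v) u = F u ∨ (u == v)

  module FixedSet (F : Fin n → Bool) where
    open Orbits (Fixing F) (natural-action n) public

    stabilizer≡fixing : ∀ v g → stabilizer v g ≡ Subgroup.member (Fixing (F +v v)) g
    stabilizer≡fixing v g = bool-ext
      (λ q → let (pe , fF) = ∧-elim (proj₁ (∧-elim q)) in
        ∧-intro pe (fixes-intro (fixes-F+v (fixes-elim fF) (==⇒≡ (proj₂ (∧-elim q))))))
      (λ q → let (pe , fFv) = ∧-elim q in
        ∧-intro (∧-intro pe (fixes-intro λ u Fu → fixes-elim fFv u (cong (_∨ (u == v)) Fu)))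
                (≡⇒== (fixes-elim fFv v (trans (cong (F v ∨_) (≡⇒== {a = v} refl)) (BoolP.∨-zeroʳ (F v))))))
      where
      fixes-F+v : (∀ u → F u ≡ true → ap g u ≡ u) → ap g v ≡ v → ∀ u → (F +v v) u ≡ true → ap g u ≡ u
      fixes-F+v fixF gv≡v u Fvu with ∨-elim Fvu
      ... | inj₁ Fu = fixF u Fu
      ... | inj₂ u=v = subst (λ w → ap g w ≡ w) (sym (==⇒≡ u=v)) gv≡v

    -- the orbit of a child of a fixed vertex p consists of children of p
    orbit-of-child : ∀ {p v} → F p ≡ true → E p v ≡ true → cnt (orbit v) ≤ 2
    orbit-of-child {p} {v} Fp pv =
      ≤-trans (cnt-mono orbit⊆children) (subst (_≤ 2) (countTrue≡cnt (E p)) (outdeg≤2 p))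
      where
      open ≡-Reasoning
      orbit⊆children : ∀ y → orbit v y ≡ true → E p y ≡ true
      orbit⊆children y o with orbit-elim o
      ... | g , g∈H , gv≡y = begin
        E p y               ≡⟨ cong₂ E (fixes-elim (proj₂ (∧-elim g∈H)) p Fp) gv≡y ⟨
        E (ap g p) (ap g v) ≡⟨ preserves-edges-elim (proj₁ (∧-elim g∈H)) p v ⟩
        E p v               ≡⟨ pv ⟩
        true                ∎

    extend-power-of-two : ∀ {p v} → F p ≡ true → E p v ≡ true → ∀ a →
      cnt (Subgroup.member (Fixing (F +v v))) ≡ 2 ^ a → ∃[ b ] cnt (Subgroup.member (Fixing F)) ≡ 2 ^ b
    extend-power-of-two {p} {v} Fp pv a order≡2^a
      with small-*-pow2 (cnt (orbit v)) a (cnt-pos v (orbit-refl v)) (orbit-of-child Fp pv)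
    ... | b , orbit*2^a≡2^b = b , (begin
      cnt (Subgroup.member (Fixing F))      ≡⟨ orbit-stabilizer v ⟩
      cnt (orbit v) * cnt (stabilizer v)    ≡⟨ cong (cnt (orbit v) *_) (cnt-cong (stabilizer≡fixing v)) ⟩
      cnt (orbit v) * cnt (Subgroup.member (Fixing (F +v v))) ≡⟨ cong (cnt (orbit v) *_) order≡2^a ⟩
      cnt (orbit v) * 2 ^ a                 ≡⟨ orbit*2^a≡2^b ⟩
      2 ^ b                                 ∎)
      where open ≡-Reasoning

  fixing-everything : ∀ (F : Fin n → Bool) → (∀ v → F v ≡ true) → cnt (Subgroup.member (Fixing F)) ≡ 1
  fixing-everything F everything = cnt-single ε (Subgroup.member-ε (Fixing F))
    (λ c q → code-ext λ v → trans (fixes-elim (proj₂ (∧-elim q)) v (everything v)) (sym (ap-ε v)))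

  adding-shrinks : ∀ (F : Fin n → Bool) {v} → F v ≡ false → cnt (λ u → not ((F +v v) u)) < cnt (λ u → not (F u))
  adding-shrinks F {v} Fv = cnt-strict v shrink outside-before outside-after
    where
    shrink : ∀ u → not ((F +v v) u) ≡ true → not (F u) ≡ true
    shrink u q with F u
    ... | false = refl
    outside-before : not ((F +v v) v) ≡ false
    outside-before = cong not (trans (cong (F v ∨_) (≡⇒== {a = v} refl)) (BoolP.∨-zeroʳ (F v)))
    outside-after : not (F v) ≡ true
    outside-after = cong not Fv

  path-from-root : ∀ {w} → ¬ (w ≡ root) → Path E root w
  path-from-root {w} w≢root with connected w
  ... | inj₁ w≡root = ⊥-elim (w≢root w≡root)
  ... | inj₂ path   = path

  -- Every subgroup fixing a set F containing the root has order a power of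
  -- two: while some vertex lies outside F, a path from the root leaves F
  -- along an edge p → v, and extend-power-of-two adds v to F.
  fixing-power-of-two : ∀ fuel (F : Fin n → Bool) → cnt (λ v → not (F v)) ≤ fuel → F root ≡ true →
                        ∃[ a ] cnt (Subgroup.member (Fixing F)) ≡ 2 ^ a
  fixing-power-of-two fuel F bound F-root with anyB (λ v → not (F v)) in outside
  ... | false = 0 , fixing-everything F (λ v →
    trans (sym (BoolP.not-involutive (F v))) (cong not (anyB-false {p = λ v → not (F v)} outside v)))
  ... | true with anyB-elim {p = λ v → not (F v)} outside
  fixing-power-of-two zero F bound F-root | true | w , w∉F
    with () ← ≤-trans (cnt-pos {p = λ v → not (F v)} w w∉F) bound
  fixing-power-of-two (suc fuel) F bound F-root | true | w , w∉F
    with leaving-edge F (path-from-root w≢root) F-root Fw≡false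
    where
    Fw≡false : F w ≡ false
    Fw≡false = trans (sym (BoolP.not-involutive (F w))) (cong not w∉F)
    w≢root : ¬ (w ≡ root)
    w≢root refl with () ← trans (sym F-root) Fw≡false
  ... | p , v , Fp , Fv , pv with fixing-power-of-two fuel (F +v v)
          (≤-pred (≤-trans (adding-shrinks F Fv) bound)) (cong (_∨ (root == v)) F-root)
  ... | a , order≡2^a = FixedSet.extend-power-of-two F Fp pv a order≡2^a

  complement-bound : ∀ (F : Fin n → Bool) → cnt (λ v → not (F v)) ≤ n
  complement-bound F = ≤-trans (cnt-mono {p = λ v → not (F v)} {q = λ _ → true} (λ _ _ → refl)) (≤-reflexive (cnt-all n))

  -- |Aut N| is a power of two, as Aut N fixes the root.
  aut-power-of-two : ∃[ a ] cnt (Subgroup.member Aut) ≡ 2 ^ a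
  aut-power-of-two with fixing-power-of-two n (_== root) (complement-bound (_== root)) (≡⇒== {a = root} refl)
  ... | a , order≡2^a = a , trans (cnt-cong Aut≡Fixing-root) order≡2^a
    where
    Aut≡Fixing-root : ∀ c → Subgroup.member Aut c ≡ Subgroup.member (Fixing (_== root)) c
    Aut≡Fixing-root c = bool-ext
      (λ q → ∧-intro (proj₁ (∧-elim q)) (fixes-intro λ v v=root →
        subst (λ w → ap c w ≡ w) (sym (==⇒≡ v=root)) (aut-fixes-root q)))
      (λ q → ∧-intro (proj₁ (∧-elim q)) (fixes-intro {c = c} λ _ ()))

  is-leaf : Fin n → Bool
  is-leaf v = does ((indeg v ≟ 1) ×-dec (outdeg v ≟ 0))

  root-or-leaf : Fin n → Bool
  root-or-leaf v = (v == root) ∨ is-leaf v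

  leaf-fixing-power-of-two : ∃[ b ] cnt (Subgroup.member (Fixing root-or-leaf)) ≡ 2 ^ b
  leaf-fixing-power-of-two =
    fixing-power-of-two n root-or-leaf (complement-bound root-or-leaf) (cong (_∨ is-leaf root) (≡⇒== {a = root} refl))

iso-refl : ∀ {ℓ} (N : Network ℓ) → IsoVia (λ i → i) N N
iso-refl N = ↔-id _ , (λ u v → refl) , (λ i → refl)

iso-trans : ∀ {ℓ} {τ τ′ : Fin ℓ → Fin ℓ} {N M P : Network ℓ} →
            IsoVia τ N M → IsoVia τ′ M P → IsoVia (λ i → τ′ (τ i)) N P
iso-trans {τ = τ} (f , f-edges , f-labels) (g , g-edges , g-labels) =
  (g ↔-∘ f) , (λ u v → trans (g-edges _ _) (f-edges u v)) ,
  (λ i → trans (cong (Inverse.to g) (f-labels i)) (g-labels (τ i)))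

iso-sym : ∀ {ℓ} (σ : Permutation′ ℓ) {N M : Network ℓ} →
          IsoVia (σ ⟨$⟩ʳ_) N M → IsoVia (σ ⟨$⟩ˡ_) M N
iso-sym σ {N} {M} (f , f-edges , f-labels) = ↔-sym f ,
  (λ u v → trans (sym (f-edges _ _)) (cong₂ (Network.E M) (Inverse.strictlyInverseˡ f u) (Inverse.strictlyInverseˡ f v))) ,
  (λ j → trans (cong (Inverse.from f) (sym (trans (f-labels (σ ⟨$⟩ˡ j)) (cong (Network.label M) (inverseʳ σ)))))
               (Inverse.strictlyInverseʳ f _))

iso-cong : ∀ {ℓ} {τ τ′ : Fin ℓ → Fin ℓ} {N M : Network ℓ} → (∀ i → τ i ≡ τ′ i) →
           IsoVia τ N M → IsoVia τ′ N M
iso-cong {M = M} τ≗τ′ (f , f-edges , f-labels) = f , f-edges , (λ i → trans (f-labels i) (cong (Network.label M) (τ≗τ′ i)))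

-- N with its leaf labels permuted by σ: the leaf labelled i becomes σ i.
relabel : ∀ {ℓ} → Network ℓ → Permutation′ ℓ → Network ℓ
relabel N σ = record N
  { label      = λ j → Network.label N (σ ⟨$⟩ˡ j)
  ; label-inj  = λ q → trans (sym (inverseʳ σ)) (trans (cong (σ ⟨$⟩ʳ_) (Network.label-inj N q)) (inverseʳ σ))
  ; label-leaf = λ j → Network.label-leaf N _
  ; label-onto = λ v leaf → σ ⟨$⟩ʳ proj₁ (Network.label-onto N v leaf) ,
                 trans (cong (Network.label N) (inverseˡ σ)) (proj₂ (Network.label-onto N v leaf))
  }

relabel-iso : ∀ {ℓ} (N : Network ℓ) (σ : Permutation′ ℓ) → IsoVia (σ ⟨$⟩ʳ_) N (relabel N σ)
relabel-iso N σ = ↔-id _ , (λ u v → refl) , (λ i → sym (cong (Network.label N) (inverseˡ σ)))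

odd-coprime : ∀ d → ¬ (2 ∣ d) → Coprime d 2
odd-coprime d 2∤d {zero}                (_ , 0∣2) with () ← 0∣⇒≡0 0∣2
odd-coprime d 2∤d {suc zero}            _ = refl
odd-coprime d 2∤d {suc (suc zero)}      (2∣d , _) = ⊥-elim (2∤d 2∣d)
odd-coprime d 2∤d {suc (suc (suc i))}   (_ , i∣2) with ∣⇒≤ i∣2
... | s≤s (s≤s ())

divisor-of-pow2 : ∀ e d → d ∣ 2 ^ e → ∃[ f ] d ≡ 2 ^ f
divisor-of-pow2 zero    d d∣1 = 0 , ∣1⇒≡1 d∣1
divisor-of-pow2 (suc e) d d∣2^e+1 with 2 ∣? d
... | no 2∤d = divisor-of-pow2 e d (coprime-divisor (odd-coprime d 2∤d) d∣2^e+1)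
... | yes (divides r refl) with divisor-of-pow2 e r (*-cancelʳ-∣ 2 (subst (r * 2 ∣_) (*-comm 2 (2 ^ e)) d∣2^e+1))
...   | f , r≡2^f = suc f , trans (cong (_* 2) r≡2^f) (*-comm (2 ^ f) 2)

pow2-factor : ∀ s a b → s * 2 ^ b ≡ 2 ^ a → ∃[ e ] s ≡ 2 ^ e
pow2-factor s a b s2^b≡2^a = divisor-of-pow2 a s (divides (2 ^ b) (trans (sym s2^b≡2^a) (*-comm s (2 ^ b))))

numerator-denominator-coprime : ∀ q → Coprime ∣ ↥ q ∣ (↧ₙ q)
numerator-denominator-coprime (mkℚ _ _ coprime) = recompute coprime

-- If L divides k · 2^e, the reduced denominator of k / L divides 2^e: writing
-- k = a·g and L = d·g with g = gcd(k, L) and a, d coprime, d·g ∣ a·2^e·g.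
reduced-denominator-divides : ∀ k L .{{_ : NonZero L}} e → L ∣ k * 2 ^ e → ↧ₙ ((ℤ.+ k) / L) ∣ 2 ^ e
reduced-denominator-divides k L e L∣k2^e =
  coprime-divisor (Coprime-sym a⊥d) (*-cancelʳ-∣ g {{g≢0}} dg∣a2^eg)
  where
  q = (ℤ.+ k) / L
  a = ∣ ↥ q ∣
  d = ↧ₙ q
  g = ∣ gcd (ℤ.+ k) (ℤ.+ L) ∣
  ag≡k : a * g ≡ k
  ag≡k = trans (sym (ℤP.abs-* (↥ q) (gcd (ℤ.+ k) (ℤ.+ L)))) (cong ∣_∣ (↥-/ (ℤ.+ k) L))
  dg≡L : d * g ≡ L
  dg≡L = trans (sym (ℤP.abs-* (↧ q) (gcd (ℤ.+ k) (ℤ.+ L)))) (cong ∣_∣ (↧-/ (ℤ.+ k) L))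
  a⊥d : Coprime a d
  a⊥d = numerator-denominator-coprime q
  g≢0 : NonZero g
  g≢0 = ≢-nonZero λ g≡0 → ≢-nonZero⁻¹ L (trans (sym dg≡L) (trans (cong (d *_) g≡0) (*-zeroʳ d)))
  dg∣a2^eg : d * g ∣ (a * 2 ^ e) * g
  dg∣a2^eg = subst₂ _∣_ (sym dg≡L) (begin
    k * 2 ^ e         ≡⟨ cong (_* 2 ^ e) ag≡k ⟨
    a * g * 2 ^ e     ≡⟨ *-assoc a g (2 ^ e) ⟩
    a * (g * 2 ^ e)   ≡⟨ cong (a *_) (*-comm g (2 ^ e)) ⟩
    a * (2 ^ e * g)   ≡⟨ *-assoc a (2 ^ e) g ⟨
    a * 2 ^ e * g     ∎) L∣k2^e
    where open ≡-Reasoning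

DividesTimesPow2 : ℕ → ℕ → Set
DividesTimesPow2 d a = ∃[ e ] d ∣ a * 2 ^ e

divides-times-pow2-0 : ∀ d → DividesTimesPow2 d 0
divides-times-pow2-0 d = 0 , (d ∣0)

divides-times-pow2-+ : ∀ d a b → DividesTimesPow2 d a → DividesTimesPow2 d b → DividesTimesPow2 d (a + b)
divides-times-pow2-+ d a b (e , d∣a2^e) (f , d∣b2^f) =
  e + f , subst (d ∣_) (sym split) (∣m∣n⇒∣m+n (∣m⇒∣m*n (2 ^ f) d∣a2^e) (∣m⇒∣m*n (2 ^ e) d∣b2^f))
  where
  split : (a + b) * 2 ^ (e + f) ≡ a * 2 ^ e * 2 ^ f + b * 2 ^ f * 2 ^ e
  split = begin
    (a + b) * 2 ^ (e + f)                 ≡⟨ cong ((a + b) *_) (^-distribˡ-+-* 2 e f) ⟩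
    (a + b) * (2 ^ e * 2 ^ f)             ≡⟨ *-distribʳ-+ (2 ^ e * 2 ^ f) a b ⟩
    a * (2 ^ e * 2 ^ f) + b * (2 ^ e * 2 ^ f)
      ≡⟨ cong₂ _+_ (sym (*-assoc a (2 ^ e) (2 ^ f)))
                   (trans (cong (b *_) (*-comm (2 ^ e) (2 ^ f))) (sym (*-assoc b (2 ^ f) (2 ^ e)))) ⟩
    a * 2 ^ e * 2 ^ f + b * 2 ^ f * 2 ^ e ∎
    where open ≡-Reasoning

Whole : ∀ m → Subgroup m
Whole m = record
  { member = λ _ → true ; member-ε = refl ; member-∙ = λ _ _ _ _ → refl ; member-⁻¹ = λ _ _ → refl }

-- Sym ℓ acts on the isomorphism classes of C_ℓ (enumerated by Fin k) by
-- permuting leaf labels; the action is well defined as C is closed under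
-- permutations.
module LabelAction (C : Class) (closed : ClosedUnderPermutations C) (ℓ k : ℕ) (card : HasCard C ℓ k) where
  open Sym ℓ

  rep : Fin k → Network ℓ
  rep = proj₁ card

  rep-in-C : ∀ x → C ℓ (rep x)
  rep-in-C = proj₁ (proj₂ card)

  rep-distinct : ∀ x y → rep x ≅ rep y → x ≡ y
  rep-distinct = proj₁ (proj₂ (proj₂ card))

  rep-covers : ∀ N → C ℓ N → ∃[ x ] N ≅ rep x
  rep-covers = proj₂ (proj₂ (proj₂ card))

  relabelled-class : ∀ σ x → ∃[ y ] relabel (rep x) (decode ℓ σ) ≅ rep y
  relabelled-class σ x = rep-covers (relabel (rep x) (decode ℓ σ))
    (closed ℓ (decode ℓ σ) (rep x) _ (rep-in-C x) (relabel-iso (rep x) (decode ℓ σ)))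

  act : Code → Fin k → Fin k
  act σ x = proj₁ (relabelled-class σ x)

  act-iso : ∀ σ x → IsoVia (ap σ) (rep x) (rep (act σ x))
  act-iso σ x = iso-trans {τ = decode ℓ σ ⟨$⟩ʳ_} {τ′ = λ i → i} {N = rep x} {M = relabel (rep x) (decode ℓ σ)} {P = rep (act σ x)} (relabel-iso (rep x) (decode ℓ σ))
                          (proj₂ (relabelled-class σ x))

  act-unique : ∀ σ x y → IsoVia (ap σ) (rep x) (rep y) → act σ x ≡ y
  act-unique σ x y iso = rep-distinct _ _
    (iso-cong {N = rep (act σ x)} {M = rep y} (λ i → inverseʳ (decode ℓ σ))
      (iso-trans {τ = decode ℓ σ ⟨$⟩ˡ_} {τ′ = ap σ} {N = rep (act σ x)} {M = rep x} {P = rep y} (iso-sym (decode ℓ σ) {rep x} {rep (act σ x)} (act-iso σ x)) iso))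

  action : Action ℓ k
  action = record
    { act   = act
    ; act-∙ = λ a b x → act-unique _ _ _
        (iso-cong {N = rep x} {M = rep (act a (act b x))} (λ i → sym (ap-∙ a b i))
          (iso-trans {τ = ap b} {τ′ = ap a} {N = rep x} {M = rep (act b x)} {P = rep (act a (act b x))} (act-iso b x) (act-iso a (act b x))))
    ; act-ε = λ x → act-unique _ _ _
        (iso-cong {N = rep x} {M = rep x} (λ i → sym (ap-ε i)) (iso-refl (rep x)))
    }

  open Orbits (Whole ℓ) action

  -- The stabilizer of the class x is the image of Aut (rep x) in Sym ℓ
  -- (each automorphism permutes the leaves, hence their labels), and the
  -- kernel is the group of automorphisms fixing the root and all leaves.
  module ClassStabilizer (x : Fin k) where
    N = rep x
    open Network N using (n; label; label-inj; label-leaf; label-onto)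
    open Automorphisms N
    module V = Sym n

    induces : V.Code → Code → Bool
    induces c σ = allB (λ i → V.ap c (label i) == label (ap σ i))

    induces-elim : ∀ {c σ} → induces c σ ≡ true → ∀ i → V.ap c (label i) ≡ label (ap σ i)
    induces-elim q i = ==⇒≡ (allB-elim q i)

    induces-intro : ∀ {c σ} → (∀ i → V.ap c (label i) ≡ label (ap σ i)) → induces c σ ≡ true
    induces-intro h = allB-intro (λ i → ≡⇒== (h i))

    image-label : ∀ {c} → IsAut c → Fin ℓ → Fin ℓ
    image-label q i = proj₁ (label-onto _ (aut-leaf q (label i) (label-leaf i)))

    image-label-spec : ∀ {c} (q : IsAut c) i → label (image-label q i) ≡ V.ap c (label i)
    image-label-spec q i = proj₂ (label-onto _ (aut-leaf q (label i) (label-leaf i)))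

    induced : ∀ {c} → IsAut c → Permutation′ ℓ
    induced {c} q = permutation (image-label q) (image-label q⁻¹) undo redo
      where
      q⁻¹ = Subgroup.member-⁻¹ Aut c q
      undo : ∀ j → image-label q (image-label q⁻¹ j) ≡ j
      undo j = label-inj (trans (image-label-spec q _)
        (trans (cong (V.ap c) (image-label-spec q⁻¹ j)) (V.ap-⁻¹ʳ c _)))
      redo : ∀ i → image-label q⁻¹ (image-label q i) ≡ i
      redo i = label-inj (trans (image-label-spec q⁻¹ _)
        (trans (cong (V.ap (c V.⁻¹)) (image-label-spec q i)) (V.ap-⁻¹ˡ c _)))

    induces-unique : ∀ c → IsAut c → cnt (induces c) ≡ 1
    induces-unique c q = cnt-single (encode ℓ (induced q)) induces-induced
      (λ σ r → code-ext λ i → label-inj (trans (sym (induces-elim r i)) (induces-elim induces-induced i)))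
      where
      induces-induced : induces c (encode ℓ (induced q)) ≡ true
      induces-induced = induces-intro λ i →
        trans (sym (image-label-spec q i)) (cong label (sym (decode-encode ℓ (induced q) i)))

    induces-translate : ∀ h g σ → induces h σ ≡ true → induces (h V.∙ g) σ ≡ induces g ε
    induces-translate h g σ hσ = bool-ext
      (λ r → induces-intro λ i → trans
        (V.ap-injective h (trans (sym (V.ap-∙ h g _)) (trans (induces-elim r i) (sym (induces-elim hσ i)))))
        (cong label (sym (ap-ε i))))
      (λ r → induces-intro λ i → begin
        V.ap (h V.∙ g) (label i)  ≡⟨ V.ap-∙ h g _ ⟩
        V.ap h (V.ap g (label i)) ≡⟨ cong (V.ap h) (trans (induces-elim r i) (cong label (ap-ε i))) ⟩
        V.ap h (label i)          ≡⟨ induces-elim hσ i ⟩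
        label (ap σ i)            ∎)
      where open ≡-Reasoning

    image : Code → Bool
    image σ = anyB (λ c → Subgroup.member Aut c ∧ induces c σ)

    kernel : V.Code → Bool
    kernel c = Subgroup.member Aut c ∧ induces c ε

    aut-order : cnt (Subgroup.member Aut) ≡ cnt image * cnt kernel
    aut-order = Subgroup.order-by-fibres Aut induces ε induces-unique induces-translate

    stabilizer≡image : ∀ σ → stabilizer x σ ≡ image σ
    stabilizer≡image σ = bool-ext from-iso to-iso
      where
      from-iso : (act σ x == x) ≡ true → image σ ≡ true
      from-iso fixed with subst (λ y → IsoVia (ap σ) N (rep y)) (==⇒≡ fixed) (act-iso σ x)
      ... | f , f-edges , f-labels =
        anyB-intro (encode n f) (∧-intro (aut-intro λ u v → trans (cong₂ E (is-f u) (is-f v)) (f-edges u v))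
                                         (induces-intro λ i → trans (is-f _) (f-labels i)))
        where
        E = Network.E N
        is-f : ∀ u → V.ap (encode n f) u ≡ Inverse.to f u
        is-f = decode-encode n f
      to-iso : image σ ≡ true → (act σ x == x) ≡ true
      to-iso q with anyB-elim q
      ... | c , c∈Aut∧induces = let (c∈Aut , cσ) = ∧-elim c∈Aut∧induces in
        ≡⇒== (act-unique σ x x (decode n c , aut-preserves-edges c∈Aut , induces-elim cσ))

    kernel≡leaf-fixing : ∀ c → kernel c ≡ Subgroup.member (Fixing root-or-leaf) c
    kernel≡leaf-fixing c = bool-ext to from
      where
      to : kernel c ≡ true → Subgroup.member (Fixing root-or-leaf) c ≡ true
      to q = let (c∈Aut , fixes-labels) = ∧-elim q in
        ∧-intro (proj₁ (∧-elim c∈Aut)) (fixes-intro λ v root-or-leaf-v → fixed c∈Aut fixes-labels v root-or-leaf-v)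
        where
        fixed : IsAut c → induces c ε ≡ true → ∀ v → root-or-leaf v ≡ true → V.ap c v ≡ v
        fixed c∈Aut fixes-labels v rl with ∨-elim rl
        ... | inj₁ v=root = subst (λ w → V.ap c w ≡ w) (sym (==⇒≡ v=root)) (aut-fixes-root c∈Aut)
        ... | inj₂ leaf with label-onto v (does-true ((_ ≟ 1) ×-dec (_ ≟ 0)) leaf)
        ...   | i , labelled-v = begin
          V.ap c v         ≡⟨ cong (V.ap c) labelled-v ⟨
          V.ap c (label i) ≡⟨ induces-elim fixes-labels i ⟩
          label (ap ε i)   ≡⟨ cong label (ap-ε i) ⟩
          label i          ≡⟨ labelled-v ⟩
          v                ∎
          where open ≡-Reasoning
      from : Subgroup.member (Fixing root-or-leaf) c ≡ true → kernel c ≡ true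
      from q = let (pe , fixes-root-leaves) = ∧-elim q in
        ∧-intro (∧-intro pe (fixes-intro {c = c} λ _ ()))
                (induces-intro λ i → trans (fixes-elim fixes-root-leaves (label i) (leaf-label i))
                                           (cong label (sym (ap-ε i))))
        where
        leaf-label : ∀ i → root-or-leaf (label i) ≡ true
        leaf-label i = trans (cong (label i == Network.root N ∨_)
                                   (dec-true ((_ ≟ 1) ×-dec (_ ≟ 0)) (label-leaf i)))
                             (BoolP.∨-zeroʳ _)

    stabilizer-power-of-two : ∃[ e ] cnt (stabilizer x) ≡ 2 ^ e
    stabilizer-power-of-two =
      let (a , |Aut|≡2^a) = aut-power-of-two
          (b , |kernel|≡2^b) = leaf-fixing-power-of-two
          (e , |image|≡2^e) = pow2-factor (cnt image) a b (begin
            cnt image * 2 ^ b         ≡⟨ cong (cnt image *_) (trans (cnt-cong kernel≡leaf-fixing) |kernel|≡2^b) ⟨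
            cnt image * cnt kernel    ≡⟨ aut-order ⟨
            cnt (Subgroup.member Aut) ≡⟨ |Aut|≡2^a ⟩
            2 ^ a                     ∎)
      in e , trans (cnt-cong stabilizer≡image) |image|≡2^e
      where open ≡-Reasoning

  orbit-divides : ∀ x → DividesTimesPow2 (ℓ !) (cnt (orbit x))
  orbit-divides x =
    let (e , |stab|≡2^e) = ClassStabilizer.stabilizer-power-of-two x
    in e , divides 1 (begin
      cnt (orbit x) * 2 ^ e              ≡⟨ cong (cnt (orbit x) *_) |stab|≡2^e ⟨
      cnt (orbit x) * cnt (stabilizer x) ≡⟨ orbit-stabilizer x ⟨
      cnt {ℓ !} (λ _ → true)             ≡⟨ cnt-all (ℓ !) ⟩
      ℓ !                                ≡⟨ *-identityˡ (ℓ !) ⟨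
      1 * ℓ !                            ∎)
    where open ≡-Reasoning

  factorial-divides : DividesTimesPow2 (ℓ !) k
  factorial-divides = orbit-induction (DividesTimesPow2 (ℓ !))
    (divides-times-pow2-0 (ℓ !)) (divides-times-pow2-+ (ℓ !)) orbit-divides

-- imported last: the prefix +_ would make sections such as (n +_) ambiguous
open import Data.Integer using (+_)

corollary1 : (C : Class) → ClosedUnderPermutations C →
    ∀ (ℓ k : ℕ) → HasCard C ℓ k →
      ∃[ e ] ↧ₙ (_/_ (+ k) (ℓ !) {{ℓ !≢0}}) ≡ 2 ^ e
corollary1 C closed ℓ k card =
  let (e , ℓ!∣k·2^e) = LabelAction.factorial-divides C closed ℓ k card
  in divisor-of-pow2 e _ (reduced-denominator-divides k (ℓ !) {{ℓ !≢0}} e ℓ!∣k·2^e)
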